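{- Let $a,b,k$ be integers with $k\ge b>a\ge 1$. The set $\mathcal{D}_{a,b,k}$ of partitions $(\pi_1,\dots,\pi_\ell)$ with all parts congruent to $a$ or $b$ modulo $k$ and with $\pi_i-\pi_{i+1}\ge k$ for $1\le i<\ell$, strict inequality if $\pi_i\equiv b\pmod k$, is a separable integer partition class with modulus $k$.
   Context: A partition is a finite non-increasing sequence of positive integers. For a positive integer $k$, a set $\mathcal{P}$ of partitions is a separable integer partition class with modulus $k$ if there is a subset $\mathcal{B}\subset\mathcal{P}$ (the basis) such that for each integer $m\ge1$ the number of partitions in $\mathcal{B}$ with $m$ parts is finite, every partition in $\mathcal{P}$ with $m$ parts is uniquely of the form $(b_1+\pi_1,\dots,b_m+\pi_m)$ where $(b_1,\dots,b_m)\in\mathcal{B}$ and $(\pi_1,\dots,\pi_m)$ is a non-increasing sequence of nonnegative integers each divisible by $k$, and all partitions of this form lie in $\mathcal{P}$. -}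

module Defs where

open import Data.Nat using (ℕ; _+_; _≤_; _<_; _≥_; ∣_-_∣)
open import Data.Nat.Divisibility using (_∣_)
open import Data.List using (List; length; zipWith)
open import Data.List.Relation.Unary.All using (All)
open import Data.List.Relation.Unary.Linked using (Linked)
open import Data.List.Membership.Propositional using (_∈_)
open import Data.Product using (Σ; _×_; ∃)
open import Data.Sum using (_⊎_)
open import Relation.Binary.PropositionalEquality using (_≡_)

_≡_[mod_] : ℕ → ℕ → ℕ → Set
x ≡ y [mod k ] = k ∣ ∣ x - y ∣

IsPartition : List ℕ → Set
IsPartition p = Linked _≥_ p × All (1 ≤_) p

IsKSeq : ℕ → List ℕ → Set
IsKSeq k π = Linked _≥_ π × All (k ∣_) π

IsDecomp : ℕ → (List ℕ → Set) → ℕ → List ℕ → List ℕ → Set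
IsDecomp k B m b π = B b × length b ≡ m × length π ≡ m × IsKSeq k π

IsSeparable : ℕ → (List ℕ → Set) → Set₁
IsSeparable k P =
  Σ (List ℕ → Set) λ B →
    (∀ b → B b → P b)
    × (∀ m → 1 ≤ m →
        (∃ λ (L : List (List ℕ)) → ∀ b → B b → length b ≡ m → b ∈ L)
        × (∀ p → P p → length p ≡ m →
             Σ (List ℕ) λ b → Σ (List ℕ) λ π →
               IsDecomp k B m b π × p ≡ zipWith _+_ b π)
        × (∀ b π b′ π′ → IsDecomp k B m b π → IsDecomp k B m b′ π′ →
             zipWith _+_ b π ≡ zipWith _+_ b′ π′ → b ≡ b′ × π ≡ π′)
        × (∀ b π → IsDecomp k B m b π → P (zipWith _+_ b π)))

DGap : ℕ → ℕ → ℕ → ℕ → Set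
DGap b k x y = (y + k ≤ x) × (x ≡ b [mod k ] → y + k < x)

D : ℕ → ℕ → ℕ → List ℕ → Set
D a b k p = IsPartition p
          × All (λ x → x ≡ a [mod k ] ⊎ x ≡ b [mod k ]) p
          × Linked (DGap b k) p

-- Write every part as r + k q with 1 ≤ r ≤ k, so that r ∈ {a, b} is its residue class and q
-- its quotient.  The gap condition between consecutive parts with quotients q and q′ then says
-- exactly q ≥ q′ + 1 if the smaller part is ≡ a, and q ≥ q′ + 2 if it is ≡ b.  So a partition
-- in D is determined by its sequence of classes together with how far each quotient exceeds
-- the least value allowed by the classes of the later parts; these excesses form an arbitrary
-- non-increasing sequence.  The basis consists of the partitions where every excess is 0, one
-- for each sequence of classes, and adding k times the excesses recovers the partition.
module Submission where

open import Defs
open import Data.Nat.Base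
  using (ℕ; zero; suc; _+_; _*_; _∸_; _≤_; _<_; _≥_; NonZero; >-nonZero; z<s)
open import Data.Nat.Properties
open import Data.Nat.Divisibility using (_∣_; divides; ∣⇒≤; m∣m*n)
open import Data.List using (List; []; _∷_; length; zipWith; map; _++_)
open import Data.Nat.ListAction using (sum)
open import Data.List.Properties using (∷-injective; length-map)
open import Data.List.Membership.Propositional using (_∈_)
open import Data.List.Membership.Propositional.Properties using (∈-map⁺; ∈-++⁺ˡ; ∈-++⁺ʳ)
open import Data.List.Relation.Unary.All as All using (All; []; _∷_)
open import Data.List.Relation.Unary.Any using (here)
open import Data.List.Relation.Unary.Linked as Linked using (Linked; []; [-]; _∷_)
open import Data.List.Relation.Unary.Linked.Properties as Linkedₚ using ()
open import Data.Product using (Σ; _×_; ∃; ∃₂; _,_; proj₁; proj₂; uncurry)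
open import Data.Sum using (_⊎_; inj₁; inj₂)
open import Function using (_∘_)
open import Relation.Nullary using (yes; no; ¬_; contradiction)
open import Relation.Binary.PropositionalEquality

module _ (k : ℕ) where

  quotient-mono : ∀ {r r′ m n} → 1 ≤ r → r′ ≤ k → r + k * m ≤ r′ + k * n → m ≤ n
  quotient-mono {r} {r′} {m} {n} 1≤r r′≤k le = ≮⇒≥ λ n<m → <⇒≱ (begin-strict
      r′ + k * n  ≤⟨ +-monoˡ-≤ (k * n) r′≤k ⟩
      k + k * n   ≡⟨ *-suc k n ⟨
      k * suc n   ≤⟨ *-monoʳ-≤ k n<m ⟩
      k * m       <⟨ m<n+m (k * m) 1≤r ⟩
      r + k * m   ∎) le
    where open ≤-Reasoning

  +k*-injective : ∀ {r r′ m n} → 1 ≤ r → r ≤ k → 1 ≤ r′ → r′ ≤ k →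
                  r + k * m ≡ r′ + k * n → r ≡ r′ × m ≡ n
  +k*-injective {r} {r′} {m} 1≤r r≤k 1≤r′ r′≤k eq =
    +-cancelʳ-≡ (k * m) r r′ (trans eq (cong (λ q → r′ + k * q) (sym m≡n))) , m≡n
    where
    m≡n = ≤-antisym (quotient-mono 1≤r r′≤k (≤-reflexive eq))
                    (quotient-mono 1≤r′ r≤k (≤-reflexive (sym eq)))

  ≡[mod]⇒+k* : ∀ {x r} → 1 ≤ x → r ≤ k → x ≡ r [mod k ] → ∃ λ q → x ≡ r + k * q
  ≡[mod]⇒+k* {x} {r} 1≤x r≤k k∣∣x-r∣ with r ≤? x
  ... | no r≰x = contradiction (∣⇒≤ {{>-nonZero (m<n⇒0<n∸m x<r)}} k∣r∸x) (<⇒≱ r∸x<k)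
    where
    x<r = ≰⇒> r≰x
    k∣r∸x = subst (k ∣_) (m≤n⇒∣m-n∣≡n∸m (<⇒≤ x<r)) k∣∣x-r∣
    r∸x<k = <-≤-trans (∸-monoʳ-< {r} {x} {0} 1≤x (<⇒≤ x<r)) r≤k
  ... | yes r≤x with subst (k ∣_) (m≤n⇒∣n-m∣≡n∸m r≤x) k∣∣x-r∣
  ... | divides q x∸r≡q*k = q , (begin
      x            ≡⟨ m+[n∸m]≡n r≤x ⟨
      r + (x ∸ r)  ≡⟨ cong (r +_) (trans x∸r≡q*k (*-comm q k)) ⟩
      r + k * q    ∎)
    where open ≡-Reasoning

  +k*≡[mod] : ∀ r q → (r + k * q) ≡ r [mod k ]
  +k*≡[mod] r q = subst (k ∣_) (sym (trans (m≤n⇒∣n-m∣≡n∸m (m≤m+n r (k * q))) (m+n∸m≡n r (k * q))))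
                        (m∣m*n q)

  multiples : ∀ {π} → All (k ∣_) π → ∃ λ cs → π ≡ map (k *_) cs
  multiples [] = [] , refl
  multiples (divides c refl ∷ k∣π) with multiples k∣π
  ... | cs , refl = c ∷ cs , cong (_∷ map (k *_) cs) (*-comm c k)

  map-*-nonincreasing⁻ : ∀ .{{_ : NonZero k}} {cs} → Linked _≥_ (map (k *_) cs) → Linked _≥_ cs
  map-*-nonincreasing⁻ = Linked.map (*-cancelˡ-≤ k) ∘ Linkedₚ.map⁻

  map-*-nonincreasing⁺ : ∀ {cs} → Linked _≥_ cs → Linked _≥_ (map (k *_) cs)
  map-*-nonincreasing⁺ = Linkedₚ.map⁺ ∘ Linked.map (*-monoʳ-≤ k)

  All-∣-map-* : ∀ cs → All (k ∣_) (map (k *_) cs)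
  All-∣-map-* [] = []
  All-∣-map-* (c ∷ cs) = m∣m*n c ∷ All-∣-map-* cs

data Class : Set where
  [a] [b] : Class

allClasses : ℕ → List (List Class)
allClasses zero = [] ∷ []
allClasses (suc n) = map ([a] ∷_) (allClasses n) ++ map ([b] ∷_) (allClasses n)

∈-allClasses : ∀ cls → cls ∈ allClasses (length cls)
∈-allClasses [] = here refl
∈-allClasses ([a] ∷ cls) = ∈-++⁺ˡ (∈-map⁺ ([a] ∷_) (∈-allClasses cls))
∈-allClasses ([b] ∷ cls) =
  ∈-++⁺ʳ (map ([a] ∷_) (allClasses (length cls))) (∈-map⁺ ([b] ∷_) (∈-allClasses cls))

minDrop : Class → ℕ
minDrop [a] = 1
minDrop [b] = 2

minQuotient : List Class → ℕ
minQuotient cls = sum (map minDrop cls)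

module Separable (a b k : ℕ) (1≤a : 1 ≤ a) (a<b : a < b) (b≤k : b ≤ k) where

  a≤k : a ≤ k
  a≤k = <⇒≤ (<-≤-trans a<b b≤k)

  instance
    k≢0 : NonZero k
    k≢0 = >-nonZero (≤-trans 1≤a a≤k)

  residue : Class → ℕ
  residue [a] = a
  residue [b] = b

  1≤residue : ∀ c → 1 ≤ residue c
  1≤residue [a] = 1≤a
  1≤residue [b] = ≤-trans 1≤a (<⇒≤ a<b)

  residue≤k : ∀ c → residue c ≤ k
  residue≤k [a] = a≤k
  residue≤k [b] = b≤k

  residue-injective : ∀ {c c′} → residue c ≡ residue c′ → c ≡ c′
  residue-injective {[a]} {[a]} _ = refl
  residue-injective {[b]} {[b]} _ = refl
  residue-injective {[a]} {[b]} a≡b = contradiction a≡b (<⇒≢ a<b)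
  residue-injective {[b]} {[a]} b≡a = contradiction (sym b≡a) (<⇒≢ a<b)

  part : Class → ℕ → ℕ
  part c q = residue c + k * q

  1≤part : ∀ c q → 1 ≤ part c q
  1≤part c q = ≤-trans (1≤residue c) (m≤m+n (residue c) (k * q))

  part-class : ∀ c q → part c q ≡ a [mod k ] ⊎ part c q ≡ b [mod k ]
  part-class [a] q = inj₁ (+k*≡[mod] k a q)
  part-class [b] q = inj₂ (+k*≡[mod] k b q)

  part-injective : ∀ {c c′ q q′} → part c q ≡ part c′ q′ → c ≡ c′ × q ≡ q′
  part-injective {c} {c′} eq
    with +k*-injective k (1≤residue c) (residue≤k c) (1≤residue c′) (residue≤k c′) eq
  ... | r≡r′ , q≡q′ = residue-injective r≡r′ , q≡q′

  part-[a]≢b : ∀ q → ¬ part [a] q ≡ b [mod k ]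
  part-[a]≢b q ≡b with ≡[mod]⇒+k* k (1≤part [a] q) b≤k ≡b
  ... | _ , eq = contradiction (proj₁ (part-injective {[a]} {[b]} eq)) λ ()

  part-+ : ∀ c q n → part c q + k * n ≡ part c (q + n)
  part-+ c q n = begin
    residue c + k * q + k * n    ≡⟨ +-assoc (residue c) (k * q) (k * n) ⟩
    residue c + (k * q + k * n)  ≡⟨ cong (residue c +_) (*-distribˡ-+ k q n) ⟨
    residue c + k * (q + n)      ∎
    where open ≡-Reasoning

  part-suc : ∀ c q → part c q + k ≡ part c (suc q)
  part-suc c q = begin
    part c q + k      ≡⟨ cong (part c q +_) (*-identityʳ k) ⟨
    part c q + k * 1  ≡⟨ part-+ c q 1 ⟩
    part c (q + 1)    ≡⟨ cong (part c) (+-comm q 1) ⟩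
    part c (suc q)    ∎
    where open ≡-Reasoning

  part-monoʳ-≤ : ∀ c {q q′} → q ≤ q′ → part c q ≤ part c q′
  part-monoʳ-≤ c q≤q′ = +-monoʳ-≤ (residue c) (*-monoʳ-≤ k q≤q′)

  part-cancelʳ-< : ∀ c {q q′} → part c q < part c q′ → q < q′
  part-cancelʳ-< c {q} {q′} lt = *-cancelˡ-< k q q′ (+-cancelˡ-< (residue c) (k * q) (k * q′) lt)

  part-[a]<part-[b] : ∀ q → part [a] q < part [b] q
  part-[a]<part-[b] q = +-monoˡ-< (k * q) a<b

  <⇒DGap : ∀ {x y} → y + k < x → DGap b k x y
  <⇒DGap y+k<x = <⇒≤ y+k<x , λ _ → y+k<x

  drop⇒gap : ∀ c c′ {q q′} → minDrop c′ + q′ ≤ q → DGap b k (part c q) (part c′ q′)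
  drop⇒gap [a] [a] {q} {q′} le = y+k≤x , λ ≡b → contradiction ≡b (part-[a]≢b q)
    where
    open ≤-Reasoning
    y+k≤x = begin
      part [a] q′ + k    ≡⟨ part-suc [a] q′ ⟩
      part [a] (suc q′)  ≤⟨ part-monoʳ-≤ [a] le ⟩
      part [a] q         ∎
  drop⇒gap [b] [a] {q} {q′} le = <⇒DGap (begin-strict
      part [a] q′ + k    ≡⟨ part-suc [a] q′ ⟩
      part [a] (suc q′)  <⟨ part-[a]<part-[b] (suc q′) ⟩
      part [b] (suc q′)  ≤⟨ part-monoʳ-≤ [b] le ⟩
      part [b] q         ∎)
    where open ≤-Reasoning
  drop⇒gap c [b] {q} {q′} le = <⇒DGap (begin-strict
      part [b] q′ + k        ≡⟨ part-suc [b] q′ ⟩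
      b + k * suc q′         ≤⟨ +-monoˡ-≤ (k * suc q′) b≤k ⟩
      k + k * suc q′         ≡⟨ *-suc k (suc q′) ⟨
      k * suc (suc q′)       <⟨ m<n+m (k * suc (suc q′)) (1≤residue c) ⟩
      part c (suc (suc q′))  ≤⟨ part-monoʳ-≤ c le ⟩
      part c q               ∎)
    where open ≤-Reasoning

  gap⇒drop : ∀ c c′ {q q′} → DGap b k (part c q) (part c′ q′) → minDrop c′ + q′ ≤ q
  gap⇒drop [a] [a] {q} {q′} (y+k≤x , _) =
    quotient-mono k 1≤a a≤k (subst (_≤ part [a] q) (part-suc [a] q′) y+k≤x)
  gap⇒drop [b] [a] {q} {q′} (_ , strict) =
    -- the strict gap reads (a + 1) + k (q′ + 1) ≤ b + k q
    quotient-mono k z<s b≤k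
      (subst (λ y → suc y ≤ part [b] q) (part-suc [a] q′) (strict (+k*≡[mod] k b q)))
  gap⇒drop [a] [b] {q} {q′} (y+k≤x , _) = part-cancelʳ-< [a] (begin-strict
      part [a] (suc q′)  <⟨ part-[a]<part-[b] (suc q′) ⟩
      part [b] (suc q′)  ≡⟨ part-suc [b] q′ ⟨
      part [b] q′ + k    ≤⟨ y+k≤x ⟩
      part [a] q         ∎)
    where open ≤-Reasoning
  gap⇒drop [b] [b] {q} {q′} (_ , strict) =
    part-cancelʳ-< [b] (subst (_< part [b] q) (part-suc [b] q′) (strict (+k*≡[mod] k b q)))

  IsPart : ℕ → Set
  IsPart x = ∃₂ λ c q → x ≡ part c q

  positive∧class⇒IsPart : ∀ {x} → 1 ≤ x → x ≡ a [mod k ] ⊎ x ≡ b [mod k ] → IsPart x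
  positive∧class⇒IsPart 1≤x (inj₁ x≡a) = [a] , ≡[mod]⇒+k* k 1≤x a≤k x≡a
  positive∧class⇒IsPart 1≤x (inj₂ x≡b) = [b] , ≡[mod]⇒+k* k 1≤x b≤k x≡b

  D⇒parts : ∀ {p} → D a b k p → All IsPart p × Linked (DGap b k) p
  D⇒parts ((_ , 1≤p) , classes , gaps) =
    All.zipWith (uncurry positive∧class⇒IsPart) (1≤p , classes) , gaps

  parts⇒D : ∀ {p} → All IsPart p → Linked (DGap b k) p → D a b k p
  parts⇒D parts gaps =
    (Linked.map (λ gap → ≤-trans (m≤m+n _ k) (proj₁ gap)) gaps , All.map positive parts) ,
    All.map inClass parts , gaps
    where
    positive : ∀ {x} → IsPart x → 1 ≤ x
    positive (c , q , refl) = 1≤part c q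
    inClass : ∀ {x} → IsPart x → x ≡ a [mod k ] ⊎ x ≡ b [mod k ]
    inClass (c , q , refl) = part-class c q

  basis : List Class → List ℕ
  basis [] = []
  basis (c ∷ cls) = part c (minQuotient cls) ∷ basis cls

  IsBasis : List ℕ → Set
  IsBasis β = ∃ λ cls → β ≡ basis cls

  length-basis : ∀ cls → length (basis cls) ≡ length cls
  length-basis [] = refl
  length-basis (c ∷ cls) = cong suc (length-basis cls)

  basis⊆D : ∀ β → IsBasis β → D a b k β
  basis⊆D _ (cls , refl) = parts⇒D (parts cls) (gaps cls)
    where
    parts : ∀ cls → All IsPart (basis cls)
    parts [] = []
    parts (c ∷ cls) = (c , minQuotient cls , refl) ∷ parts cls
    gaps : ∀ cls → Linked (DGap b k) (basis cls)
    gaps [] = []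
    gaps (c ∷ []) = [-]
    gaps (c ∷ c′ ∷ cls) = drop⇒gap c c′ ≤-refl ∷ gaps (c′ ∷ cls)

  shift : List Class → List ℕ → List ℕ
  shift (c ∷ cls) (e ∷ es) = part c (minQuotient cls + e) ∷ shift cls es
  shift _ _ = []

  zipWith-basis-multiples : ∀ cls es → zipWith _+_ (basis cls) (map (k *_) es) ≡ shift cls es
  zipWith-basis-multiples [] es = refl
  zipWith-basis-multiples (c ∷ cls) [] = refl
  zipWith-basis-multiples (c ∷ cls) (e ∷ es) =
    cong₂ _∷_ (part-+ c (minQuotient cls) e) (zipWith-basis-multiples cls es)

  shift∈D : ∀ cls {es} → Linked _≥_ es → D a b k (shift cls es)
  shift∈D cls es↓ = parts⇒D (parts cls _) (gaps cls es↓)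
    where
    parts : ∀ cls es → All IsPart (shift cls es)
    parts (c ∷ cls) (e ∷ es) = (c , minQuotient cls + e , refl) ∷ parts cls es
    parts [] _ = []
    parts (_ ∷ _) [] = []
    gaps : ∀ cls {es} → Linked _≥_ es → Linked (DGap b k) (shift cls es)
    gaps (c ∷ c′ ∷ cls) {e ∷ e′ ∷ es} (e′≤e ∷ es↓) =
      drop⇒gap c c′ (subst (_≤ minQuotient (c′ ∷ cls) + e)
                           (+-assoc (minDrop c′) (minQuotient cls) e′)
                           (+-monoʳ-≤ (minQuotient (c′ ∷ cls)) e′≤e))
      ∷ gaps (c′ ∷ cls) es↓
    gaps [] _ = []
    gaps (_ ∷ []) {[]} _ = []
    gaps (_ ∷ []) {_ ∷ _} _ = [-]
    gaps (_ ∷ _ ∷ _) {[]} _ = []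
    gaps (_ ∷ _ ∷ _) {_ ∷ []} _ = [-]

  shift-injective : ∀ {cls es cls′ es′} → length es ≡ length cls → length es′ ≡ length cls′ →
                    shift cls es ≡ shift cls′ es′ → cls ≡ cls′ × es ≡ es′
  shift-injective {[]} {[]} {[]} {[]} _ _ _ = refl , refl
  shift-injective {c ∷ cls} {e ∷ es} {c′ ∷ cls′} {e′ ∷ es′} l l′ eq
    with part-injective (proj₁ (∷-injective eq))
       | shift-injective (suc-injective l) (suc-injective l′) (proj₂ (∷-injective eq))
  ... | refl , h+e≡h+e′ | refl , refl =
    refl , cong (_∷ es) (+-cancelˡ-≡ (minQuotient cls) e e′ h+e≡h+e′)
  shift-injective {[]} {[]} {_ ∷ _} {_ ∷ _} _ _ ()

  record Shifted (p : List ℕ) : Set where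
    constructor shifted
    field
      classes : List Class
      excesses : List ℕ
      length-classes : length classes ≡ length p
      length-excesses : length excesses ≡ length classes
      excesses-nonincreasing : Linked _≥_ excesses
      p≡shift : p ≡ shift classes excesses

  unshift : ∀ {p} → All IsPart p → Linked (DGap b k) p → Shifted p
  unshift [] _ = shifted [] [] refl refl [] refl
  unshift ((c , q , refl) ∷ []) _ = shifted (c ∷ []) (q ∷ []) refl refl [-] refl
  unshift ((c , q , refl) ∷ parts@(_ ∷ _)) (gap ∷ gaps) with unshift parts gaps
  ... | shifted [] _ () _ _ _
  ... | shifted (_ ∷ _) [] _ () _ _
  ... | shifted (c′ ∷ cls) (e′ ∷ es) lc le es↓ refl =
    shifted (c ∷ c′ ∷ cls) (q ∸ h ∷ e′ ∷ es) (cong suc lc) (cong suc le) (e′≤q∸h ∷ es↓)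
            (cong (λ n → part c n ∷ _) (sym (m+[n∸m]≡n (m+n≤o⇒m≤o h h+e′≤q))))
    where
    h = minQuotient (c′ ∷ cls)
    h+e′≤q : h + e′ ≤ q
    h+e′≤q = subst (_≤ q) (sym (+-assoc (minDrop c′) (minQuotient cls) e′)) (gap⇒drop c c′ gap)
    e′≤q∸h : e′ ≤ q ∸ h
    e′≤q∸h = m+n≤o⇒m≤o∸n e′ (subst (_≤ q) (+-comm h e′) h+e′≤q)

  basis-finite : ∀ m → ∃ λ L → ∀ β → IsBasis β → length β ≡ m → β ∈ L
  basis-finite m = map basis (allClasses m) , λ { _ (cls , refl) length≡m →
    subst (λ n → basis cls ∈ map basis (allClasses n)) (trans (sym (length-basis cls)) length≡m)
          (∈-map⁺ basis (∈-allClasses cls)) }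

  decomposition : ∀ m p → D a b k p → length p ≡ m →
                  Σ (List ℕ) λ β → Σ (List ℕ) λ π → IsDecomp k IsBasis m β π × p ≡ zipWith _+_ β π
  decomposition m p p∈D refl with uncurry unshift (D⇒parts p∈D)
  ... | shifted cls es lc le es↓ p≡shift =
    basis cls , map (k *_) es ,
    ((cls , refl) , trans (length-basis cls) lc , trans (length-map (k *_) es) (trans le lc) ,
     map-*-nonincreasing⁺ k es↓ , All-∣-map-* k es) ,
    trans p≡shift (sym (zipWith-basis-multiples cls es))

  length-aligned : ∀ {m} cls es → length (basis cls) ≡ m → length (map (k *_) es) ≡ m →
                   length es ≡ length cls
  length-aligned cls es lβ lπ =
    trans (sym (length-map (k *_) es)) (trans lπ (trans (sym lβ) (length-basis cls)))

  decomposition-unique : ∀ m β π β′ π′ → IsDecomp k IsBasis m β π → IsDecomp k IsBasis m β′ π′ →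
                         zipWith _+_ β π ≡ zipWith _+_ β′ π′ → β ≡ β′ × π ≡ π′
  decomposition-unique m _ _ _ _
    ((cls , refl) , lβ , lπ , _ , k∣π) ((cls′ , refl) , lβ′ , lπ′ , _ , k∣π′) eq
    with multiples k k∣π | multiples k k∣π′
  ... | es , refl | es′ , refl
    with shift-injective (length-aligned cls es lβ lπ) (length-aligned cls′ es′ lβ′ lπ′)
           (trans (sym (zipWith-basis-multiples cls es))
                  (trans eq (zipWith-basis-multiples cls′ es′)))
  ... | refl , refl = refl , refl

  decomposition-closed : ∀ m β π → IsDecomp k IsBasis m β π → D a b k (zipWith _+_ β π)
  decomposition-closed _ _ _ ((cls , refl) , _ , _ , π↓ , k∣π) with multiples k k∣π
  ... | es , refl =
    subst (D a b k) (sym (zipWith-basis-multiples cls es)) (shift∈D cls (map-*-nonincreasing⁻ k π↓))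

mainTheorem13 : (a b k : ℕ) → 1 ≤ a → a < b → b ≤ k → IsSeparable k (D a b k)
mainTheorem13 a b k 1≤a a<b b≤k =
  IsBasis , basis⊆D ,
  λ m _ → basis-finite m , decomposition m , decomposition-unique m , decomposition-closed m
  where open Separable a b k 1≤a a<b b≤k
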